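{- Let $n\geqslant 1$ and $k\geqslant 1$ be integers and let $m$ be a divisor of $n$ with $\gcd(k,n/m)=1$. Then the maximal cardinality of a $k$-free set contained in $A_m$ is $$R_k(A_m)=\frac{\varphi(n/m)}{l_k(n/m)}\cdot\frac{l_k(n/m)-I(l_k(n/m))}{2}.$$
   Context: Everything takes place in $\mathbb{Z}/n\mathbb{Z}$; a set $A\subset\mathbb{Z}/n\mathbb{Z}$ is $k$-free if for all $x\in A$, $kx\notin A$. For a divisor $m$ of $n$, $A_m=\{x\in\mathbb{Z}/n\mathbb{Z} : \gcd(x,n)=m\}$. For $d$ coprime to $k$, $l_k(d)$ is the multiplicative order of $k$ in $(\mathbb{Z}/d\mathbb{Z})^*$ (with $l_k(1)=1$); $I$ is the indicator function of the odd integers; $\varphi$ is Euler's totient function. -}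

module Defs where

open import Data.Nat using (ℕ; zero; suc; _+_; _*_; _∸_; _^_; _≤_; _<_; NonZero)
open import Data.Nat.DivMod using (_%_; m%n<n)
open import Data.Nat.GCD using (gcd)
open import Data.Nat.Properties using (_≟_)
open import Data.Fin using (Fin; toℕ; fromℕ<)
open import Data.Fin.Subset using (Subset; _∈_; _∉_)
open import Data.Product using (_×_)
open import Relation.Binary.PropositionalEquality using (_≡_)
open import Relation.Nullary using (¬_; yes; no)

-- ℤ/nℤ is modelled by Fin n (residues 0 … n-1), for n ≥ 1.
-- Multiplication by k in ℤ/nℤ.
mulMod : (n : ℕ) .{{_ : NonZero n}} → ℕ → Fin n → Fin n
mulMod n k x = fromℕ< (m%n<n (k * toℕ x) n)

KFree : (n : ℕ) .{{_ : NonZero n}} → ℕ → Subset n → Set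
KFree n k A = ∀ (x : Fin n) → x ∈ A → mulMod n k x ∉ A

-- A ⊆ A_m = { x ∈ ℤ/nℤ : gcd(x,n) = m }  (with gcd(0,n) = n)
SubsetOfA : (n m : ℕ) → Subset n → Set
SubsetOfA n m A = ∀ (x : Fin n) → x ∈ A → gcd (toℕ x) n ≡ m

-- l is the multiplicative order of k modulo d:
-- the least l ≥ 1 with k^l ≡ 1 (mod d).  (For d = 1 this gives l = 1.)
IsMultOrder : ℕ → ℕ → ℕ → Set
IsMultOrder k d l =
  (1 ≤ l) × (((k ^ l) % suc (d ∸ 1)) ≡ (1 % suc (d ∸ 1)))
    × (∀ j → 1 ≤ j → j < l → ¬ (((k ^ j) % suc (d ∸ 1)) ≡ (1 % suc (d ∸ 1))))

countCoprime : ℕ → ℕ → ℕ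
countCoprime zero d = zero
countCoprime (suc c) d with gcd (suc c) d ≟ 1
... | yes _ = suc (countCoprime c d)
... | no _ = countCoprime c d

φ : ℕ → ℕ
φ d = countCoprime d d

I : ℕ → ℕ
I l = l % 2

module Submission where

-- Write n = m q.  Then Aₘ = m · (ℤ/qℤ)ˣ, so |Aₘ| = φ(q), and multiplication by k permutes Aₘ
-- with every orbit a cycle of exact length l, the order of k mod q; so Aₘ is a union of φ(q)/l
-- such cycles.  A k-free set contains no two cyclically consecutive points of a cycle, hence at
-- most ⌊l/2⌋ = (l − I(l))/2 of them (double counting over the l rotations of each cycle makes
-- this global).  Conversely, taking in every cycle the points at odd distance before its least
-- element gives a k-free set with exactly ⌊l/2⌋ points per cycle.

open import Defs
open import Data.Nat.Properties
open import Algebra.Properties.Semiring.Sum +-*-semiring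
  using (sum-syntax; sum-cong-≗; ∑-distrib-+; ∑-comm; ∑-permute; *-distribˡ-sum; *-distribʳ-sum)
open import Data.Bool.Base using (Bool; true; false; T; if_then_else_)
open import Data.Bool.Properties using (T-≡)
open import Data.Empty using (⊥-elim-irr)
open import Data.Fin.Base using (Fin; zero; suc; toℕ; fromℕ<)
open import Data.Fin.Permutation using (Permutation′; permutation)
open import Data.Fin.Properties using (toℕ<n; toℕ-injective; toℕ-fromℕ<; any?; all?)
open import Data.Fin.Subset using (Subset; ∣_∣; _∈_; _∉_)
open import Data.Nat.Base
  using (ℕ; zero; suc; pred; _+_; _*_; _∸_; _^_; _≤_; _<_; _≡ᵇ_; z≤n; s≤s; s≤s⁻¹; z<s; NonZero; >-nonZero⁻¹)
open import Data.Nat.Coprimality using (Coprime; coprime-divisor; coprime⇒gcd≡1; gcd≡1⇒coprime)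
  renaming (sym to ⊥-sym)
open import Data.Nat.Divisibility
  using (_∣_; divides; ∣-refl; ∣-trans; ∣-antisym; n∣m*n; ∣m+n∣m⇒∣n; ∣n∣m%n⇒∣m; >⇒∤)
open import Data.Nat.DivMod
  using (_/_; _%_; m%n<n; m≡m%n+[m/n]*n; m*n/n≡m; m/n≡1+[m∸n]/n; /-monoˡ-≤; [m+n]%n≡m%n; %-distribˡ-*;
         m%n%n≡m%n; %-remove-+ʳ; m<n⇒m%n≡m; %-congʳ; m%n*o≡m*o%[n*o])
open import Data.Nat.GCD using (gcd; gcd[m,n]∣m; gcd-greatest; gcd-identityˡ; c*gcd[m,n]≡gcd[cm,cn])
open import Data.Nat.GeneralisedArithmetic using (fold; fold-+)
open import Data.Nat.Induction using (<-wellFounded)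
open import Data.Product using (_×_; _,_; proj₁; Σ-syntax; ∃-syntax)
open import Data.Sum.Base using (inj₁; inj₂; [_,_]′)
open import Data.Vec.Base using ([]; _∷_; lookup; tabulate)
open import Data.Vec.Properties using (lookup⇒[]=; []=⇒lookup; lookup∘tabulate)
open import Function.Base using (_∘_)
open import Function.Bundles using (_⇔_; mk⇔; Equivalence)
open import Induction.WellFounded using (Acc; acc)
open import Relation.Binary.Definitions using (tri<; tri≈; tri>)
open import Relation.Binary.PropositionalEquality
  using (_≡_; _≢_; refl; sym; trans; cong; cong₂; subst; module ≡-Reasoning)
open import Relation.Nullary using (¬_; Dec; yes; no; contradiction)
open import Relation.Nullary.Decidable using (T?; _×-dec_; ⌊_⌋; toWitness; fromWitness; does-⇔; isYes≗does)

⟦_⟧ : Bool → ℕ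
⟦ true ⟧ = 1
⟦ false ⟧ = 0

⟦⟧≤1 : ∀ b → ⟦ b ⟧ ≤ 1
⟦⟧≤1 true = ≤-refl
⟦⟧≤1 false = z≤n

T⇒⟦⟧≡1 : ∀ {b} → T b → ⟦ b ⟧ ≡ 1
T⇒⟦⟧≡1 {true} _ = refl

⌊⌋-⇔ : ∀ {a b} {A : Set a} {B : Set b} → A ⇔ B → (a? : Dec A) (b? : Dec B) → ⌊ a? ⌋ ≡ ⌊ b? ⌋
⌊⌋-⇔ A⇔B a? b? = trans (isYes≗does a?) (trans (does-⇔ A⇔B a? b?) (sym (isYes≗does b?)))

¬T⇒⟦⟧≡0 : ∀ {b} → ¬ T b → ⟦ b ⟧ ≡ 0
¬T⇒⟦⟧≡0 {true} ¬t = contradiction _ ¬t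
¬T⇒⟦⟧≡0 {false} _ = refl

⟦c≡ᵇ1⟧≡c : ∀ {c} → c ≤ 1 → ⟦ c ≡ᵇ 1 ⟧ ≡ c
⟦c≡ᵇ1⟧≡c {zero} _ = refl
⟦c≡ᵇ1⟧≡c {suc zero} _ = refl
⟦c≡ᵇ1⟧≡c {suc (suc _)} (s≤s ())

∑-mono-≤ : ∀ {n} {f g : Fin n → ℕ} → (∀ x → f x ≤ g x) → ∑[ x < n ] f x ≤ ∑[ x < n ] g x
∑-mono-≤ {zero} h = z≤n
∑-mono-≤ {suc n} h = +-mono-≤ (h zero) (∑-mono-≤ (h ∘ suc))

∑< : ℕ → (ℕ → ℕ) → ℕ
∑< l f = ∑[ i < l ] f (toℕ i)

∑<-cong : ∀ l {f g} → (∀ i → i < l → f i ≡ g i) → ∑< l f ≡ ∑< l g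
∑<-cong l h = sum-cong-≗ (λ i → h (toℕ i) (toℕ<n i))

∑<-mono-≤ : ∀ l {f g} → (∀ i → i < l → f i ≤ g i) → ∑< l f ≤ ∑< l g
∑<-mono-≤ l h = ∑-mono-≤ (λ i → h (toℕ i) (toℕ<n i))

∑<-const : ∀ l c → ∑< l (λ _ → c) ≡ l * c
∑<-const zero c = refl
∑<-const (suc l) c = cong (c +_) (∑<-const l c)

∑<-zero : ∀ l {f} → (∀ i → i < l → f i ≡ 0) → ∑< l f ≡ 0
∑<-zero l h = trans (∑<-cong l h) (trans (∑<-const l 0) (*-zeroʳ l))

∑<-single : ∀ {l f} i₀ → i₀ < l → (∀ i → i < l → i ≢ i₀ → f i ≡ 0) → ∑< l f ≡ f i₀
∑<-single {suc l} {f} zero _ h = trans (cong (f 0 +_) (∑<-zero l (λ i i<l → h (suc i) (s≤s i<l) λ ()))) (+-identityʳ _)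
∑<-single {suc l} (suc i₀) (s≤s i₀<l) h =
  cong₂ _+_ (h 0 z<s λ ()) (∑<-single i₀ i₀<l (λ i i<l i≢i₀ → h (suc i) (s≤s i<l) (i≢i₀ ∘ suc-injective)))

∑<-witness : ∀ l {f} → 0 < ∑< l f → ∃[ i ] (i < l × 0 < f i)
∑<-witness (suc l) {f} pos with f 0 in f0≡
... | suc _ = 0 , z<s , subst (0 <_) (sym f0≡) z<s
... | zero with ∑<-witness l pos
...   | i , i<l , fi>0 = suc i , s≤s i<l , fi>0

∑<-snoc : ∀ l f → ∑< (suc l) f ≡ ∑< l f + f l
∑<-snoc zero f = +-identityʳ (f 0)
∑<-snoc (suc l) f = trans (cong (f 0 +_) (∑<-snoc l (f ∘ suc))) (sym (+-assoc (f 0) _ _))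

∑<-rotate : ∀ l f → f l ≡ f 0 → ∑< l (f ∘ suc) ≡ ∑< l f
∑<-rotate l f fl≡f0 =
  +-cancelˡ-≡ (f 0) _ _ (trans (∑<-snoc l f) (trans (cong (∑< l f +_) fl≡f0) (+-comm _ (f 0))))

∑<-split : ∀ a b f → ∑< (a + b) f ≡ ∑< a f + ∑< b (λ i → f (a + i))
∑<-split zero b f = refl
∑<-split (suc a) b f = trans (cong (f 0 +_) (∑<-split a b (f ∘ suc))) (sym (+-assoc (f 0) _ _))

∑<-blocks : ∀ q m f → ∑< (q * m) f ≡ ∑< q (λ y → ∑< m (λ r → f (y * m + r)))
∑<-blocks zero m f = refl
∑<-blocks (suc q) m f = trans (∑<-split m (q * m) f) (cong (∑< m f +_) (trans
  (∑<-blocks q m (λ i → f (m + i)))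
  (∑<-cong q (λ y _ → ∑<-cong m (λ r _ → cong f (sym (+-assoc m (y * m) r)))))))

I[n]>0⇒I[n]≡1 : ∀ n → 0 < I n → I n ≡ 1
I[n]>0⇒I[n]≡1 n I[n]>0 with I n | m%n<n n 2
... | suc zero | _ = refl
... | suc (suc _) | s≤s (s≤s ())

I[n]*m≤m : ∀ n m → I n * m ≤ m
I[n]*m≤m n m = ≤-trans (*-monoˡ-≤ m (s≤s⁻¹ (m%n<n n 2))) (≤-reflexive (*-identityˡ m))

I[n]*⟦b⟧>0 : ∀ n b → 0 < I n * ⟦ b ⟧ → I n ≡ 1 × T b
I[n]*⟦b⟧>0 n true pos = I[n]>0⇒I[n]≡1 n (subst (0 <_) (*-identityʳ (I n)) pos) , _
I[n]*⟦b⟧>0 n false pos = contradiction (subst (0 <_) (*-zeroʳ (I n)) pos) (λ ())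

I[2+n]≡I[n] : ∀ n → I (2 + n) ≡ I n
I[2+n]≡I[n] n = trans (cong (_% 2) (+-comm 2 n)) ([m+n]%n≡m%n n 2)

I[1+n]+I[n]≡1 : ∀ n → I (suc n) + I n ≡ 1
I[1+n]+I[n]≡1 zero = refl
I[1+n]+I[n]≡1 (suc zero) = refl
I[1+n]+I[n]≡1 (suc (suc n)) = trans (cong₂ _+_ (I[2+n]≡I[n] (suc n)) (I[2+n]≡I[n] n)) (I[1+n]+I[n]≡1 n)

∑<-I : ∀ l → ∑< l I ≡ l / 2
∑<-I zero = refl
∑<-I (suc zero) = refl
∑<-I (suc (suc l)) = begin
  suc (∑< l (λ i → I (2 + i))) ≡⟨ cong suc (∑<-cong l (λ i _ → I[2+n]≡I[n] i)) ⟩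
  suc (∑< l I)                  ≡⟨ cong suc (∑<-I l) ⟩
  suc (l / 2)                   ≡⟨ m/n≡1+[m∸n]/n {2 + l} (s≤s (s≤s z≤n)) ⟨
  (2 + l) / 2                   ∎
  where open ≡-Reasoning

[n∸I[n]]/2≡n/2 : ∀ n → (n ∸ I n) / 2 ≡ n / 2
[n∸I[n]]/2≡n/2 n = begin
  (n ∸ n % 2) / 2                       ≡⟨ cong (λ t → (t ∸ n % 2) / 2) (m≡m%n+[m/n]*n n 2) ⟩
  (n % 2 + n / 2 * 2 ∸ n % 2) / 2       ≡⟨ cong (_/ 2) (m+n∸m≡n (n % 2) _) ⟩
  n / 2 * 2 / 2                         ≡⟨ m*n/n≡m (n / 2) 2 ⟩
  n / 2                                 ∎
  where open ≡-Reasoning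

m+m≤n⇒m≤n/2 : ∀ {m n} → m + m ≤ n → m ≤ n / 2
m+m≤n⇒m≤n/2 {m} {n} m+m≤n = begin
  m         ≡⟨ m*n/n≡m m 2 ⟨
  m * 2 / 2 ≤⟨ /-monoˡ-≤ 2 (subst (_≤ n) m+m≡m*2 m+m≤n) ⟩
  n / 2     ∎
  where
  open ≤-Reasoning
  m+m≡m*2 : m + m ≡ m * 2
  m+m≡m*2 = trans (cong (m +_) (sym (+-identityʳ m))) (*-comm 2 m)

∣p∣≡∑⟦p⟧ : ∀ {n} (p : Subset n) → ∣ p ∣ ≡ ∑[ x < n ] ⟦ lookup p x ⟧
∣p∣≡∑⟦p⟧ [] = refl
∣p∣≡∑⟦p⟧ (true ∷ p) = cong suc (∣p∣≡∑⟦p⟧ p)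
∣p∣≡∑⟦p⟧ (false ∷ p) = ∣p∣≡∑⟦p⟧ p

∈⇒T-lookup : ∀ {n x} {p : Subset n} → x ∈ p → T (lookup p x)
∈⇒T-lookup x∈p = subst T (sym ([]=⇒lookup x∈p)) _

T-lookup⇒∈ : ∀ {n x} {p : Subset n} → T (lookup p x) → x ∈ p
T-lookup⇒∈ {x = x} {p} t with lookup p x in eq
... | true = lookup⇒[]= x p eq

module Iterate {A : Set} (σ : A → A) where

  σ^ : ℕ → A → A
  σ^ j x = fold x σ j

  σ^-+ : ∀ i j x → σ^ (i + j) x ≡ σ^ i (σ^ j x)
  σ^-+ i j x = fold-+ x σ i

  σ^∘σ : ∀ j x → σ^ j (σ x) ≡ σ^ (suc j) x
  σ^∘σ j x = trans (sym (σ^-+ j 1 x)) (cong (λ t → σ^ t x) (+-comm j 1))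

  σ^-fixed : ∀ {x} → σ x ≡ x → ∀ j → σ^ j x ≡ x
  σ^-fixed σx≡x zero = refl
  σ^-fixed σx≡x (suc j) = trans (cong σ (σ^-fixed σx≡x j)) σx≡x

  σ^-invariant : ∀ {B : Set} (g : A → B) → (∀ x → g (σ x) ≡ g x) → ∀ j x → g (σ^ j x) ≡ g x
  σ^-invariant g g∘σ≗g zero x = refl
  σ^-invariant g g∘σ≗g (suc j) x = trans (g∘σ≗g (σ^ j x)) (σ^-invariant g g∘σ≗g j x)

module Orbits {N : ℕ} (σ : Fin N → Fin N) (U : Fin N → Bool) (U∘σ≗U : ∀ x → U (σ x) ≡ U x)
  (l : ℕ) .{{_ : NonZero l}} (σ^l≗id : ∀ x → Iterate.σ^ σ l x ≡ x)
  (exact-period : ∀ x d → T (U x) → 1 ≤ d → d < l → Iterate.σ^ σ d x ≢ x) where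

  open Iterate σ

  σ^[c*l]≗id : ∀ c x → σ^ (c * l) x ≡ x
  σ^[c*l]≗id zero x = refl
  σ^[c*l]≗id (suc c) x = trans (σ^-+ l (c * l) x) (trans (cong (σ^ l) (σ^[c*l]≗id c x)) (σ^l≗id x))

  σ^-mod : ∀ j x → σ^ j x ≡ σ^ (j % l) x
  σ^-mod j x = begin
    σ^ j x                          ≡⟨ cong (λ t → σ^ t x) (m≡m%n+[m/n]*n j l) ⟩
    σ^ (j % l + j / l * l) x        ≡⟨ σ^-+ (j % l) (j / l * l) x ⟩
    σ^ (j % l) (σ^ (j / l * l) x)   ≡⟨ cong (σ^ (j % l)) (σ^[c*l]≗id (j / l) x) ⟩
    σ^ (j % l) x                    ∎
    where open ≡-Reasoning

  σ^-return : ∀ d x → σ^ (l ∸ d % l) (σ^ d x) ≡ x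
  σ^-return d x = begin
    σ^ (l ∸ d % l) (σ^ d x)         ≡⟨ cong (σ^ (l ∸ d % l)) (σ^-mod d x) ⟩
    σ^ (l ∸ d % l) (σ^ (d % l) x)   ≡⟨ σ^-+ (l ∸ d % l) (d % l) x ⟨
    σ^ (l ∸ d % l + d % l) x        ≡⟨ cong (λ t → σ^ t x) (m∸n+n≡m (<⇒≤ (m%n<n d l))) ⟩
    σ^ l x                          ≡⟨ σ^l≗id x ⟩
    x                               ∎
    where open ≡-Reasoning

  U∘σ^≗U : ∀ j x → U (σ^ j x) ≡ U x
  U∘σ^≗U = σ^-invariant U U∘σ≗U

  σ-permutation : Permutation′ N
  σ-permutation = permutation σ (σ^ (pred l)) σ∘σ⁻¹ σ⁻¹∘σ
    where
    σ∘σ⁻¹ : ∀ x → σ (σ^ (pred l) x) ≡ x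
    σ∘σ⁻¹ x = trans (cong (λ t → σ^ t x) (suc-pred l)) (σ^l≗id x)
    σ⁻¹∘σ : ∀ x → σ^ (pred l) (σ x) ≡ x
    σ⁻¹∘σ x = trans (σ^∘σ (pred l) x) (σ∘σ⁻¹ x)

  ∑∘σ^ : ∀ j (f : Fin N → ℕ) → ∑[ x < N ] f (σ^ j x) ≡ ∑[ x < N ] f x
  ∑∘σ^ zero f = refl
  ∑∘σ^ (suc j) f = trans (∑∘σ^ j (f ∘ σ)) (sym (∑-permute f σ-permutation))

  IsRep : Fin N → Set
  IsRep x = T (U x) × (∀ (j : Fin l) → toℕ x ≤ toℕ (σ^ (toℕ j) x))

  rep? : ∀ x → Dec (IsRep x)
  rep? x = T? (U x) ×-dec all? (λ j → toℕ x ≤? toℕ (σ^ (toℕ j) x))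

  rep : Fin N → Bool
  rep x = ⌊ rep? x ⌋

  T-rep⇒IsRep : ∀ {x} → T (rep x) → IsRep x
  T-rep⇒IsRep {x} = toWitness {a? = rep? x}

  IsRep⇒T-rep : ∀ {x} → IsRep x → T (rep x)
  IsRep⇒T-rep {x} = fromWitness {a? = rep? x}

  #reps : ℕ
  #reps = ∑[ x < N ] ⟦ rep x ⟧

  IsRep⇒minimal : ∀ {x} → IsRep x → ∀ j → toℕ x ≤ toℕ (σ^ j x)
  IsRep⇒minimal {x} (_ , min) j = begin
    toℕ x                                ≤⟨ min (fromℕ< (m%n<n j l)) ⟩
    toℕ (σ^ (toℕ (fromℕ< (m%n<n j l))) x) ≡⟨ cong (λ i → toℕ (σ^ i x)) (toℕ-fromℕ< (m%n<n j l)) ⟩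
    toℕ (σ^ (j % l) x)                   ≡⟨ cong toℕ (σ^-mod j x) ⟨
    toℕ (σ^ j x)                         ∎
    where open ≤-Reasoning

  rep-unique-in-orbit : ∀ d x → IsRep x → IsRep (σ^ d x) → σ^ d x ≡ x
  rep-unique-in-orbit d x rx ry = toℕ-injective (≤-antisym
    (≤-trans (IsRep⇒minimal ry (l ∸ d % l)) (≤-reflexive (cong toℕ (σ^-return d x))))
    (IsRep⇒minimal rx d))

  rep-index-< : ∀ {i j x} → i < j → j < l → IsRep (σ^ i x) → ¬ IsRep (σ^ j x)
  rep-index-< {i} {j} {x} i<j j<l ri rj =
    exact-period (σ^ i x) (j ∸ i) (proj₁ ri) (m<n⇒0<n∸m i<j) (≤-<-trans (m∸n≤m j i) j<l)
      (rep-unique-in-orbit (j ∸ i) (σ^ i x) ri (subst IsRep σ^j≡ rj))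
    where
    σ^j≡ : σ^ j x ≡ σ^ (j ∸ i) (σ^ i x)
    σ^j≡ = trans (cong (λ t → σ^ t x) (sym (m∸n+n≡m (<⇒≤ i<j)))) (σ^-+ (j ∸ i) i x)

  rep-index-unique : ∀ {i j x} → i < l → j < l → IsRep (σ^ i x) → IsRep (σ^ j x) → i ≡ j
  rep-index-unique {i} {j} i<l j<l ri rj with <-cmp i j
  ... | tri< i<j _ _ = contradiction rj (rep-index-< i<j j<l ri)
  ... | tri≈ _ i≡j _ = i≡j
  ... | tri> _ _ j<i = contradiction ri (rep-index-< j<i i<l rj)

  rep-in-orbit : ∀ x → T (U x) → ∃[ i ] (i < l × IsRep (σ^ i x))
  rep-in-orbit x u with descend x (<-wellFounded (toℕ x)) u
    where
    descend : ∀ y → Acc _<_ (toℕ y) → T (U y) → ∃[ i ] IsRep (σ^ i y)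
    descend y (acc rs) uy with any? (λ j → toℕ (σ^ (toℕ j) y) <? toℕ y)
    ... | no ¬smaller = 0 , uy , λ j → ≮⇒≥ (λ lt → ¬smaller (j , lt))
    ... | yes (j , lt) with descend (σ^ (toℕ j) y) (rs lt) (subst T (sym (U∘σ^≗U (toℕ j) y)) uy)
    ...   | i , r = i + toℕ j , subst IsRep (sym (σ^-+ i (toℕ j) y)) r
  ... | i , r = i % l , m%n<n i l , subst IsRep (σ^-mod i x) r

  ∑<-rep : ∀ x → ∑< l (λ i → ⟦ rep (σ^ i x) ⟧) ≡ ⟦ U x ⟧
  ∑<-rep x with U x in Ux
  ... | false = ∑<-zero l (λ i _ → ¬T⇒⟦⟧≡0 (λ t →
    subst T (trans (U∘σ^≗U i x) Ux) (proj₁ (T-rep⇒IsRep t))))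
  ... | true with rep-in-orbit x (subst T (sym Ux) _)
  ...   | i₀ , i₀<l , r = trans
    (∑<-single i₀ i₀<l (λ i i<l i≢i₀ → ¬T⇒⟦⟧≡0 (λ t →
      i≢i₀ (rep-index-unique i<l i₀<l (T-rep⇒IsRep t) r))))
    (T⇒⟦⟧≡1 (IsRep⇒T-rep r))

  ∣U∣≡l*#reps : ∑[ x < N ] ⟦ U x ⟧ ≡ l * #reps
  ∣U∣≡l*#reps = begin
    ∑[ x < N ] ⟦ U x ⟧
      ≡⟨ sum-cong-≗ (λ x → sym (∑<-rep x)) ⟩
    ∑[ x < N ] ∑< l (λ i → ⟦ rep (σ^ i x) ⟧)
      ≡⟨ ∑-comm {N} {l} (λ x i → ⟦ rep (σ^ (toℕ i) x) ⟧) ⟩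
    ∑< l (λ i → ∑[ x < N ] ⟦ rep (σ^ i x) ⟧)
      ≡⟨ ∑<-cong l (λ i _ → ∑∘σ^ i (λ x → ⟦ rep x ⟧)) ⟩
    ∑< l (λ _ → #reps)
      ≡⟨ ∑<-const l #reps ⟩
    l * #reps
      ∎
    where open ≡-Reasoning

  σ-Free : Subset N → Set
  σ-Free A = ∀ x → x ∈ A → σ x ∉ A

  module _ {A : Subset N} (A-free : σ-Free A) where

    consecutive≤1 : ∀ x → ⟦ lookup A x ⟧ + ⟦ lookup A (σ x) ⟧ ≤ 1
    consecutive≤1 x with lookup A x in Ax
    ... | false = ⟦⟧≤1 _
    ... | true with lookup A (σ x) in Aσx
    ...   | false = ≤-refl
    ...   | true = contradiction (lookup⇒[]= (σ x) A Aσx) (A-free x (lookup⇒[]= x A Ax))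

    module _ (A⊆U : ∀ x → x ∈ A → T (U x)) where

      orbit-count≤ : ∀ x → ∑< l (λ j → ⟦ lookup A (σ^ j x) ⟧) ≤ l / 2 * ⟦ U x ⟧
      orbit-count≤ x with U x in Ux
      ... | false = ≤-reflexive (trans (∑<-zero l outside) (sym (*-zeroʳ (l / 2))))
        where
        outside : ∀ j → j < l → ⟦ lookup A (σ^ j x) ⟧ ≡ 0
        outside j _ = ¬T⇒⟦⟧≡0 (λ t → subst T (trans (U∘σ^≗U j x) Ux) (A⊆U _ (T-lookup⇒∈ t)))
      ... | true = subst (∑< l f ≤_) (sym (*-identityʳ (l / 2))) (m+m≤n⇒m≤n/2 twice≤l)
        where
        f : ℕ → ℕ
        f j = ⟦ lookup A (σ^ j x) ⟧
        fl≡f0 : f l ≡ f 0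
        fl≡f0 = cong (λ y → ⟦ lookup A y ⟧) (σ^l≗id x)
        twice≤l : ∑< l f + ∑< l f ≤ l
        twice≤l = begin
          ∑< l f + ∑< l f                    ≡⟨ cong (∑< l f +_) (∑<-rotate l f fl≡f0) ⟨
          ∑< l f + ∑< l (f ∘ suc)            ≡⟨ ∑-distrib-+ {l} (f ∘ toℕ) (f ∘ suc ∘ toℕ) ⟨
          ∑< l (λ j → f j + f (suc j))       ≤⟨ ∑<-mono-≤ l (λ j _ → consecutive≤1 (σ^ j x)) ⟩
          ∑< l (λ _ → 1)                     ≡⟨ ∑<-const l 1 ⟩
          l * 1                              ≡⟨ *-identityʳ l ⟩
          l                                  ∎
          where open ≤-Reasoning

      σ-free-bound : ∣ A ∣ ≤ #reps * (l / 2)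
      σ-free-bound = *-cancelˡ-≤ l (begin
        l * ∣ A ∣
          ≡⟨ cong (l *_) (∣p∣≡∑⟦p⟧ A) ⟩
        l * ∑[ x < N ] χ x
          ≡⟨ ∑<-const l _ ⟨
        ∑< l (λ _ → ∑[ x < N ] χ x)
          ≡⟨ ∑<-cong l (λ j _ → ∑∘σ^ j χ) ⟨
        ∑< l (λ j → ∑[ x < N ] χ (σ^ j x))
          ≡⟨ ∑-comm {l} {N} (λ j x → χ (σ^ (toℕ j) x)) ⟩
        ∑[ x < N ] ∑< l (λ j → χ (σ^ j x))
          ≤⟨ ∑-mono-≤ orbit-count≤ ⟩
        ∑[ x < N ] (l / 2 * ⟦ U x ⟧)
          ≡⟨ *-distribˡ-sum {N} (l / 2) (λ x → ⟦ U x ⟧) ⟨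
        l / 2 * ∑[ x < N ] ⟦ U x ⟧
          ≡⟨ cong (l / 2 *_) ∣U∣≡l*#reps ⟩
        l / 2 * (l * #reps)
          ≡⟨ *-comm (l / 2) (l * #reps) ⟩
        l * #reps * (l / 2)
          ≡⟨ *-assoc l #reps (l / 2) ⟩
        l * (#reps * (l / 2))
          ∎)
        where
        open ≤-Reasoning
        χ : Fin N → ℕ
        χ x = ⟦ lookup A x ⟧

  -- Is 1 when the number i < l of steps from x to the representative of its orbit is odd, else 0.
  oddCount : Fin N → ℕ
  oddCount x = ∑< l (λ i → I i * ⟦ rep (σ^ i x) ⟧)

  oddCount≤1 : ∀ x → oddCount x ≤ 1
  oddCount≤1 x = begin
    oddCount x                        ≤⟨ ∑<-mono-≤ l (λ i _ → I[n]*m≤m i ⟦ rep (σ^ i x) ⟧) ⟩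
    ∑< l (λ i → ⟦ rep (σ^ i x) ⟧)     ≡⟨ ∑<-rep x ⟩
    ⟦ U x ⟧                           ≤⟨ ⟦⟧≤1 (U x) ⟩
    1                                 ∎
    where open ≤-Reasoning

  chosen : Fin N → Bool
  chosen x = oddCount x ≡ᵇ 1

  oddPositions : Subset N
  oddPositions = tabulate chosen

  oddPositions-index : ∀ {x} → x ∈ oddPositions → ∃[ i ] (i < l × I i ≡ 1 × IsRep (σ^ i x))
  oddPositions-index {x} x∈ with ∑<-witness l (subst (0 <_) (sym oddCount≡1) z<s)
    where
    oddCount≡1 : oddCount x ≡ 1
    oddCount≡1 = ≡ᵇ⇒≡ _ 1 (subst T (lookup∘tabulate chosen x) (∈⇒T-lookup x∈))
  ... | i , i<l , pos with I[n]*⟦b⟧>0 i _ pos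
  ...   | I[i]≡1 , r = i , i<l , I[i]≡1 , T-rep⇒IsRep r

  oddPositions⊆U : ∀ x → x ∈ oddPositions → T (U x)
  oddPositions⊆U x x∈ with oddPositions-index x∈
  ... | i , _ , _ , r = subst T (U∘σ^≗U i x) (proj₁ r)

  oddPositions-free : σ-Free oddPositions
  oddPositions-free x x∈ σx∈ with oddPositions-index x∈ | oddPositions-index σx∈
  ... | i , i<l , I[i]≡1 , rᵢ | j , j<l , I[j]≡1 , rⱼ with m≤n⇒m<n∨m≡n j<l
  ...   | inj₁ 1+j<l = parity-clash (cong I (rep-index-unique i<l 1+j<l rᵢ (subst IsRep (σ^∘σ j x) rⱼ)))
    where
    parity-clash : I i ≢ I (suc j)
    parity-clash I[i]≡I[1+j] = contradiction
      (trans (sym (cong₂ _+_ (trans (sym I[i]≡I[1+j]) I[i]≡1) I[j]≡1)) (I[1+n]+I[n]≡1 j)) λ ()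
  ...   | inj₂ 1+j≡l = contradiction
    (trans (sym (cong I (rep-index-unique i<l (≤-<-trans z≤n i<l) rᵢ r₀))) I[i]≡1) λ ()
    where
    r₀ : IsRep x
    r₀ = subst IsRep (trans (σ^∘σ j x) (trans (cong (λ t → σ^ t x) 1+j≡l) (σ^l≗id x))) rⱼ

  ∣oddPositions∣ : ∣ oddPositions ∣ ≡ #reps * (l / 2)
  ∣oddPositions∣ = begin
    ∣ oddPositions ∣
      ≡⟨ ∣p∣≡∑⟦p⟧ oddPositions ⟩
    ∑[ x < N ] ⟦ lookup oddPositions x ⟧
      ≡⟨ sum-cong-≗ (λ x → cong ⟦_⟧ (lookup∘tabulate chosen x)) ⟩
    ∑[ x < N ] ⟦ oddCount x ≡ᵇ 1 ⟧
      ≡⟨ sum-cong-≗ (λ x → ⟦c≡ᵇ1⟧≡c (oddCount≤1 x)) ⟩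
    ∑[ x < N ] oddCount x
      ≡⟨ ∑-comm {N} {l} (λ x i → I (toℕ i) * ⟦ rep (σ^ (toℕ i) x) ⟧) ⟩
    ∑< l (λ i → ∑[ x < N ] (I i * ⟦ rep (σ^ i x) ⟧))
      ≡⟨ ∑<-cong l (λ i _ → *-distribˡ-sum {N} (I i) (λ x → ⟦ rep (σ^ i x) ⟧)) ⟨
    ∑< l (λ i → I i * ∑[ x < N ] ⟦ rep (σ^ i x) ⟧)
      ≡⟨ ∑<-cong l (λ i _ → cong (I i *_) (∑∘σ^ i (λ x → ⟦ rep x ⟧))) ⟩
    ∑< l (λ i → I i * #reps)
      ≡⟨ *-distribʳ-sum {l} #reps (I ∘ toℕ) ⟨
    ∑< l I * #reps
      ≡⟨ cong (_* #reps) (∑<-I l) ⟩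
    l / 2 * #reps
      ≡⟨ *-comm (l / 2) #reps ⟩
    #reps * (l / 2)
      ∎
    where open ≡-Reasoning

*-coprime : ∀ {a b q} → Coprime a q → Coprime b q → Coprime (a * b) q
*-coprime {a} a⊥q b⊥q {d} (d∣ab , d∣q) = b⊥q (coprime-divisor d⊥a d∣ab , d∣q)
  where
  d⊥a : Coprime d a
  d⊥a (e∣d , e∣a) = a⊥q (e∣a , ∣-trans e∣d d∣q)

%-coprime : ∀ {a q} .{{_ : NonZero q}} → Coprime a q → Coprime (a % q) q
%-coprime a⊥q (d∣a%q , d∣q) = a⊥q (∣n∣m%n⇒∣m d∣q d∣a%q , d∣q)

[a*[b%n]]%n≡[a*b]%n : ∀ a b n .{{_ : NonZero n}} → (a * (b % n)) % n ≡ (a * b) % n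
[a*[b%n]]%n≡[a*b]%n a b n = begin
  (a * (b % n)) % n               ≡⟨ %-distribˡ-* a (b % n) n ⟩
  ((a % n) * (b % n % n)) % n     ≡⟨ cong (λ t → ((a % n) * t) % n) (m%n%n≡m%n b n) ⟩
  ((a % n) * (b % n)) % n         ≡⟨ %-distribˡ-* a b n ⟨
  (a * b) % n                     ∎
  where open ≡-Reasoning

%≡%⇒∣∸ : ∀ {a b q} .{{_ : NonZero q}} → a % q ≡ b % q → q ∣ a ∸ b
%≡%⇒∣∸ {a} {b} {q} a%q≡b%q = divides (a / q ∸ b / q) (begin
  a ∸ b                                     ≡⟨ cong₂ _∸_ (m≡m%n+[m/n]*n a q) (m≡m%n+[m/n]*n b q) ⟩
  (a % q + a / q * q) ∸ (b % q + b / q * q) ≡⟨ cong (λ t → (t + a / q * q) ∸ (b % q + b / q * q)) a%q≡b%q ⟩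
  (b % q + a / q * q) ∸ (b % q + b / q * q) ≡⟨ [m+n]∸[m+o]≡n∸o (b % q) _ _ ⟩
  a / q * q ∸ b / q * q                     ≡⟨ *-distribʳ-∸ q (a / q) (b / q) ⟨
  (a / q ∸ b / q) * q                       ∎)
  where open ≡-Reasoning

%-cancelʳ-coprime : ∀ {a b y q} .{{_ : NonZero q}} → Coprime q y → (a * y) % q ≡ (b * y) % q → a % q ≡ b % q
%-cancelʳ-coprime {a} {b} {y} {q} q⊥y ay≡by =
  [ (λ b≤a → cancel b≤a ay≡by) , (λ a≤b → sym (cancel a≤b (sym ay≡by))) ]′ (≤-total b a)
  where
  cancel : ∀ {a b} → b ≤ a → (a * y) % q ≡ (b * y) % q → a % q ≡ b % q
  cancel {a} {b} b≤a ay≡by = begin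
    a % q             ≡⟨ cong (_% q) (m+[n∸m]≡n b≤a) ⟨
    (b + (a ∸ b)) % q ≡⟨ %-remove-+ʳ b q∣a∸b ⟩
    b % q             ∎
    where
    open ≡-Reasoning
    q∣a∸b : q ∣ a ∸ b
    q∣a∸b = coprime-divisor q⊥y (subst (q ∣_) (trans (sym (*-distribʳ-∸ y a b)) (*-comm (a ∸ b) y))
      (%≡%⇒∣∸ ay≡by))

countCoprime≡∑< : ∀ c d → countCoprime c d ≡ ∑< c (λ x → ⟦ ⌊ gcd (suc x) d ≟ 1 ⌋ ⟧)
countCoprime≡∑< zero d = refl
countCoprime≡∑< (suc c) d = trans last-step (sym (∑<-snoc c (λ x → ⟦ ⌊ gcd (suc x) d ≟ 1 ⌋ ⟧)))
  where
  last-step : countCoprime (suc c) d ≡ ∑< c (λ x → ⟦ ⌊ gcd (suc x) d ≟ 1 ⌋ ⟧) + ⟦ ⌊ gcd (suc c) d ≟ 1 ⌋ ⟧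
  last-step with gcd (suc c) d ≟ 1
  ... | yes _ = trans (cong suc (countCoprime≡∑< c d)) (+-comm 1 _)
  ... | no _ = trans (countCoprime≡∑< c d) (sym (+-identityʳ _))

module GcdClass (m q : ℕ) .{{_ : NonZero m}} .{{_ : NonZero q}} where

  n : ℕ
  n = m * q

  private instance
    n≢0 : NonZero n
    n≢0 = m*n≢0 m q
    q*m≢0 : NonZero (q * m)
    q*m≢0 = m*n≢0 q m

  [c*[m*y]]%n≡m*[[c*y]%q] : ∀ c y → (c * (m * y)) % n ≡ m * ((c * y) % q)
  [c*[m*y]]%n≡m*[[c*y]%q] c y = begin
    (c * (m * y)) % (m * q)   ≡⟨ cong (_% (m * q)) (trans (cong (c *_) (*-comm m y)) (sym (*-assoc c y m))) ⟩
    (c * y * m) % (m * q)     ≡⟨ %-congʳ (*-comm m q) ⟩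
    (c * y * m) % (q * m)     ≡⟨ m%n*o≡m*o%[n*o] (c * y) q m ⟨
    (c * y) % q * m           ≡⟨ *-comm _ m ⟩
    m * ((c * y) % q)         ∎
    where open ≡-Reasoning

  gcd[m*y,n]≡m⇔gcd[y,q]≡1 : ∀ y → gcd (m * y) n ≡ m ⇔ gcd y q ≡ 1
  gcd[m*y,n]≡m⇔gcd[y,q]≡1 y = mk⇔
    (λ eq → *-cancelˡ-≡ (gcd y q) 1 m (trans m*gcd≡ (trans eq (sym (*-identityʳ m)))))
    (λ eq → trans (sym m*gcd≡) (trans (cong (m *_) eq) (*-identityʳ m)))
    where
    m*gcd≡ : m * gcd y q ≡ gcd (m * y) n
    m*gcd≡ = c*gcd[m,n]≡gcd[cm,cn] m y q

  decompose : ∀ {x} → x < n → gcd x n ≡ m → ∃[ y ] (x ≡ m * y × Coprime y q × y < q)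
  decompose {x} x<n gcd≡m with subst (_∣ x) gcd≡m (gcd[m,n]∣m x n)
  ... | divides y x≡y*m = y , x≡m*y , gcd≡1⇒coprime gcd[y,q]≡1 , *-cancelˡ-< m y q (subst (_< n) x≡m*y x<n)
    where
    x≡m*y : x ≡ m * y
    x≡m*y = trans x≡y*m (*-comm y m)
    gcd[y,q]≡1 : gcd y q ≡ 1
    gcd[y,q]≡1 = Equivalence.to (gcd[m*y,n]≡m⇔gcd[y,q]≡1 y) (subst (λ t → gcd t n ≡ m) x≡m*y gcd≡m)

  gcd-preserved : ∀ {c x} → Coprime c q → x < n → gcd x n ≡ m → gcd ((c * x) % n) n ≡ m
  gcd-preserved {c} c⊥q x<n gcd≡m with decompose x<n gcd≡m
  ... | y , refl , y⊥q , _ = begin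
    gcd ((c * (m * y)) % n) n     ≡⟨ cong (λ t → gcd t n) ([c*[m*y]]%n≡m*[[c*y]%q] c y) ⟩
    gcd (m * ((c * y) % q)) n     ≡⟨ Equivalence.from (gcd[m*y,n]≡m⇔gcd[y,q]≡1 _) cy%q⊥q ⟩
    m                             ∎
    where
    open ≡-Reasoning
    cy%q⊥q : gcd ((c * y) % q) q ≡ 1
    cy%q⊥q = coprime⇒gcd≡1 (%-coprime (*-coprime c⊥q y⊥q))

  fixes⇔≡1 : ∀ {c x} → x < n → gcd x n ≡ m → (c * x) % n ≡ x ⇔ c % q ≡ 1 % q
  fixes⇔≡1 {c} x<n gcd≡m with decompose x<n gcd≡m
  ... | y , refl , y⊥q , y<q = mk⇔
    (λ fix → %-cancelʳ-coprime (⊥-sym y⊥q) (begin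
      (c * y) % q       ≡⟨ *-cancelˡ-≡ _ _ m (trans (sym ([c*[m*y]]%n≡m*[[c*y]%q] c y)) fix) ⟩
      y                 ≡⟨ m<n⇒m%n≡m y<q ⟨
      y % q             ≡⟨ cong (_% q) (*-identityˡ y) ⟨
      (1 * y) % q       ∎))
    (λ c≡1 → trans ([c*[m*y]]%n≡m*[[c*y]%q] c y) (cong (m *_) (begin
      (c * y) % q                   ≡⟨ %-distribˡ-* c y q ⟩
      ((c % q) * (y % q)) % q       ≡⟨ cong (λ t → (t * (y % q)) % q) c≡1 ⟩
      ((1 % q) * (y % q)) % q       ≡⟨ %-distribˡ-* 1 y q ⟨
      (1 * y) % q                   ≡⟨ cong (_% q) (*-identityˡ y) ⟩
      y % q                         ≡⟨ m<n⇒m%n≡m y<q ⟩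
      y                             ∎)))
    where open ≡-Reasoning

  ∑<-gcd≡m : ∑< n (λ x → ⟦ ⌊ gcd x n ≟ m ⌋ ⟧) ≡ φ q
  ∑<-gcd≡m = begin
    ∑< (m * q) χ
      ≡⟨ cong (λ t → ∑< t χ) (*-comm m q) ⟩
    ∑< (q * m) χ
      ≡⟨ ∑<-blocks q m χ ⟩
    ∑< q (λ y → ∑< m (λ r → χ (y * m + r)))
      ≡⟨ ∑<-cong q (λ y _ → ∑<-single 0 (>-nonZero⁻¹ m) (block-rest y)) ⟩
    ∑< q (λ y → χ (y * m + 0))
      ≡⟨ ∑<-cong q (λ y _ → block-head y) ⟩
    ∑< q coprime
      ≡⟨ ∑<-rotate q coprime (cong (λ t → ⟦ ⌊ t ≟ 1 ⌋ ⟧) gcd[q,q]≡gcd[0,q]) ⟨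
    ∑< q (coprime ∘ suc)
      ≡⟨ countCoprime≡∑< q q ⟨
    φ q
      ∎
    where
    open ≡-Reasoning
    χ coprime : ℕ → ℕ
    χ x = ⟦ ⌊ gcd x n ≟ m ⌋ ⟧
    coprime y = ⟦ ⌊ gcd y q ≟ 1 ⌋ ⟧
    block-rest : ∀ y r → r < m → r ≢ 0 → χ (y * m + r) ≡ 0
    block-rest y zero _ r≢0 = contradiction refl r≢0
    block-rest y (suc r) r<m _ = ¬T⇒⟦⟧≡0 (λ t → >⇒∤ r<m (∣m+n∣m⇒∣n (m∣ t) (n∣m*n y)))
      where
      m∣ : T (⌊ gcd (y * m + suc r) n ≟ m ⌋) → m ∣ y * m + suc r
      m∣ t = subst (_∣ y * m + suc r) (toWitness t) (gcd[m,n]∣m _ n)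
    block-head : ∀ y → χ (y * m + 0) ≡ coprime y
    block-head y =
      cong ⟦_⟧ (⌊⌋-⇔ (subst (λ t → gcd t n ≡ m ⇔ gcd y q ≡ 1) m*y≡y*m+0 (gcd[m*y,n]≡m⇔gcd[y,q]≡1 y)) _ _)
      where
      m*y≡y*m+0 : m * y ≡ y * m + 0
      m*y≡y*m+0 = trans (*-comm m y) (sym (+-identityʳ _))
    gcd[q,q]≡gcd[0,q] : gcd q q ≡ gcd 0 q
    gcd[q,q]≡gcd[0,q] = trans (∣-antisym (gcd[m,n]∣m q q) (gcd-greatest ∣-refl ∣-refl)) (sym (gcd-identityˡ q))

  module MultiplicationBy (k : ℕ) (k⊥q : Coprime k q) (l : ℕ) .{{_ : NonZero l}}
    (kˡ≡1 : (k ^ l) % q ≡ 1 % q) (k-order : ∀ j → 1 ≤ j → j < l → (k ^ j) % q ≢ 1 % q) where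

    inA : Fin n → Bool
    inA x = ⌊ gcd (toℕ x) n ≟ m ⌋

    inA⇒gcd≡m : ∀ {x} → T (inA x) → gcd (toℕ x) n ≡ m
    inA⇒gcd≡m {x} = toWitness {a? = gcd (toℕ x) n ≟ m}

    gcd≡m⇒inA : ∀ {x} → gcd (toℕ x) n ≡ m → T (inA x)
    gcd≡m⇒inA {x} = fromWitness {a? = gcd (toℕ x) n ≟ m}

    -- σ is the identity off Aₘ, making it a permutation of all of ℤ/nℤ even when k is not a unit mod n.
    σ : Fin n → Fin n
    σ x = if inA x then mulMod n k x else x

    open Iterate σ

    σ-on-A : ∀ {x} → T (inA x) → σ x ≡ mulMod n k x
    σ-on-A {x} x∈A with inA x
    ... | true = refl

    σ-off-A : ∀ {x} → ¬ T (inA x) → σ x ≡ x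
    σ-off-A {x} x∉A with inA x
    ... | true = contradiction _ x∉A
    ... | false = refl

    toℕ-mulMod : ∀ c x → toℕ (mulMod n c x) ≡ (c * toℕ x) % n
    toℕ-mulMod c x = toℕ-fromℕ< (m%n<n (c * toℕ x) n)

    mulMod-preserves-A : ∀ {c x} → Coprime c q → T (inA x) → T (inA (mulMod n c x))
    mulMod-preserves-A {c} {x} c⊥q x∈A = gcd≡m⇒inA {mulMod n c x}
      (trans (cong (λ t → gcd t n) (toℕ-mulMod c x)) (gcd-preserved c⊥q (toℕ<n x) (inA⇒gcd≡m {x} x∈A)))

    inA∘σ≗inA : ∀ x → inA (σ x) ≡ inA x
    inA∘σ≗inA x with T? (inA x)
    ... | yes x∈A = trans (cong inA (σ-on-A {x} x∈A))
      (trans (Equivalence.to T-≡ (mulMod-preserves-A {k} {x} k⊥q x∈A)) (sym (Equivalence.to T-≡ x∈A)))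
    ... | no x∉A = cong inA (σ-off-A {x} x∉A)

    toℕ-σ^ : ∀ j {x} → T (inA x) → toℕ (σ^ j x) ≡ (k ^ j * toℕ x) % n
    toℕ-σ^ zero {x} _ = sym (trans (cong (_% n) (*-identityˡ (toℕ x))) (m<n⇒m%n≡m (toℕ<n x)))
    toℕ-σ^ (suc j) {x} x∈A = begin
      toℕ (σ (σ^ j x))                  ≡⟨ cong toℕ (σ-on-A {σ^ j x} σ^jx∈A) ⟩
      toℕ (mulMod n k (σ^ j x))         ≡⟨ toℕ-mulMod k (σ^ j x) ⟩
      (k * toℕ (σ^ j x)) % n            ≡⟨ cong (λ t → (k * t) % n) (toℕ-σ^ j {x} x∈A) ⟩
      (k * ((k ^ j * toℕ x) % n)) % n   ≡⟨ [a*[b%n]]%n≡[a*b]%n k _ n ⟩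
      (k * (k ^ j * toℕ x)) % n         ≡⟨ cong (_% n) (*-assoc k (k ^ j) (toℕ x)) ⟨
      (k ^ suc j * toℕ x) % n           ∎
      where
      open ≡-Reasoning
      σ^jx∈A : T (inA (σ^ j x))
      σ^jx∈A = subst T (sym (σ^-invariant inA inA∘σ≗inA j x)) x∈A

    σ^l≗id : ∀ x → σ^ l x ≡ x
    σ^l≗id x with T? (inA x)
    ... | yes x∈A = toℕ-injective (trans (toℕ-σ^ l {x} x∈A)
      (Equivalence.from (fixes⇔≡1 (toℕ<n x) (inA⇒gcd≡m {x} x∈A)) kˡ≡1))
    ... | no x∉A = σ^-fixed (σ-off-A {x} x∉A) l

    exact-period : ∀ x d → T (inA x) → 1 ≤ d → d < l → σ^ d x ≢ x
    exact-period x d x∈A 1≤d d<l σ^dx≡x = k-order d 1≤d d<l (Equivalence.to (fixes⇔≡1 (toℕ<n x) (inA⇒gcd≡m {x} x∈A))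
      (trans (sym (toℕ-σ^ d {x} x∈A)) (cong toℕ σ^dx≡x)))

    open Orbits σ inA inA∘σ≗inA l σ^l≗id exact-period public

    module _ {A : Subset n} (A⊆Aₘ : SubsetOfA n m A) where

      A⊆inA : ∀ x → x ∈ A → T (inA x)
      A⊆inA x x∈A = gcd≡m⇒inA {x} (A⊆Aₘ x x∈A)

      KFree⇒σ-Free : KFree n k A → σ-Free A
      KFree⇒σ-Free k-free x x∈A = subst (_∉ A) (sym (σ-on-A {x} (A⊆inA x x∈A))) (k-free x x∈A)

      σ-Free⇒KFree : σ-Free A → KFree n k A
      σ-Free⇒KFree σ-free x x∈A = subst (_∉ A) (σ-on-A {x} (A⊆inA x x∈A)) (σ-free x x∈A)

    oddPositions⊆Aₘ : SubsetOfA n m oddPositions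
    oddPositions⊆Aₘ x x∈ = inA⇒gcd≡m {x} (oddPositions⊆U x x∈)

    R≡#reps*l/2 : (φ q / l) * ((l ∸ I l) / 2) ≡ #reps * (l / 2)
    R≡#reps*l/2 = cong₂ _*_ φq/l≡#reps ([n∸I[n]]/2≡n/2 l)
      where
      φq/l≡#reps : φ q / l ≡ #reps
      φq/l≡#reps = begin
        φ q / l                                ≡⟨ cong (_/ l) (trans (sym ∑<-gcd≡m) ∣U∣≡l*#reps) ⟩
        l * #reps / l                          ≡⟨ cong (_/ l) (*-comm l #reps) ⟩
        #reps * l / l                          ≡⟨ m*n/n≡m #reps l ⟩
        #reps                                  ∎
        where open ≡-Reasoning

lemma7 : (n : ℕ) .{{_ : NonZero n}} → (k : ℕ) → 1 ≤ k →
    (m q : ℕ) → n ≡ m * q → Coprime k q →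
    (l : ℕ) .{{_ : NonZero l}} → IsMultOrder k q l →
    let R = (φ q / l) * ((l ∸ I l) / 2) in
    (Σ[ A ∈ Subset n ] (SubsetOfA n m A × KFree n k A × ∣ A ∣ ≡ R))
    × (∀ (A : Subset n) → SubsetOfA n m A → KFree n k A → ∣ A ∣ ≤ R)
lemma7 n {{n≢0}} k _ m zero n≡m*0 _ _ _ = ⊥-elim-irr (NonZero.nonZero (m*n≢0⇒n≢0 m {{subst NonZero n≡m*0 n≢0}}))
-- Matching q as a successor lets the modulus suc (q ∸ 1) in IsMultOrder reduce to q.
lemma7 _ {{m*q≢0}} k _ m q@(suc _) refl k⊥q l (_ , kˡ≡1 , k-order) =
  (oddPositions , oddPositions⊆Aₘ , σ-Free⇒KFree oddPositions⊆Aₘ oddPositions-free ,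
    trans ∣oddPositions∣ (sym R≡#reps*l/2)) ,
  λ A A⊆Aₘ k-free →
    subst (∣ A ∣ ≤_) (sym R≡#reps*l/2) (σ-free-bound (KFree⇒σ-Free A⊆Aₘ k-free) (A⊆inA A⊆Aₘ))
  where
  instance
    m≢0 : NonZero m
    m≢0 = m*n≢0⇒m≢0 m {{m*q≢0}}
  open GcdClass m q
  open MultiplicationBy k k⊥q l kˡ≡1 k-order
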